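{- Let $G$ and $J$ be disconnected graphs with $n$ components and $m$ components respectively. If $n, m \geq 2$, then $c_H(G \vee J) \leq 4$.
   Context: The join $G \vee J$ has vertex set $V(G) \cup V(J)$ (disjoint union) and edge set $E(G) \cup E(J) \cup \{uv : u \in V(G), v \in V(J)\}$. Hyperopic Cops and Robber on a graph $H$ (each vertex considered to carry a loop, so a player may stay put): the cops first occupy a multiset of vertices, then the robber chooses a vertex. In each round, each cop moves to an adjacent vertex or stays, then the robber moves to an adjacent vertex or stays. The robber always sees all cops. The cops see the robber's position except when the robber's vertex is adjacent to every vertex occupied by a cop, in which case the robber is invisible. The robber is captured when a cop occupies the robber's vertex. $c_H(H)$ is the minimum number of cops that can guarantee capture in finitely many moves. -}

module Defs where

open import Data.Nat using (ℕ; zero; suc; _+_; _≤_)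
open import Data.Fin using (Fin; splitAt)
open import Data.Bool using (Bool; true; false; _∧_)
open import Data.Sum using (_⊎_; inj₁; inj₂)
open import Data.Product using (Σ; ∃; ∃-syntax; _×_; _,_; proj₁; proj₂)
open import Data.Vec using (Vec; []; _∷_; lookup)
open import Data.List using (List; []; _∷_)
open import Data.Maybe using (Maybe; just; nothing)
open import Relation.Binary.PropositionalEquality using (_≡_; refl)
open import Relation.Nullary using (¬_)

record Graph : Set where
  field
    n      : ℕ
    adj    : Fin n → Fin n → Bool
    sym    : ∀ u v → adj u v ≡ adj v u
    irrefl : ∀ v → adj v v ≡ false

open Graph public

Vtx : Graph → Set
Vtx G = Fin (n G)

data Reachable (G : Graph) : Vtx G → Vtx G → Set where
  here : ∀ {u} → Reachable G u u
  step : ∀ {u w v} → adj G u w ≡ true → Reachable G w v → Reachable G u v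

Connected : Graph → Set
Connected G = ∀ u v → Reachable G u v

-- A graph with at least two components is exactly a disconnected graph.
Disconnected : Graph → Set
Disconnected G = ¬ Connected G

-- Join G ∨ J on vertex set Fin (n G + n J): first block = V(G), second = V(J).

joinAdj : (G J : Graph) → Fin (n G + n J) → Fin (n G + n J) → Bool
joinAdj G J x y with splitAt (n G) x | splitAt (n G) y
... | inj₁ a | inj₁ b = adj G a b
... | inj₂ a | inj₂ b = adj J a b
... | inj₁ _ | inj₂ _ = true
... | inj₂ _ | inj₁ _ = true

joinAdj-sym : (G J : Graph) → ∀ x y → joinAdj G J x y ≡ joinAdj G J y x
joinAdj-sym G J x y with splitAt (n G) x | splitAt (n G) y
... | inj₁ a | inj₁ b = sym G a b
... | inj₂ a | inj₂ b = sym J a b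
... | inj₁ _ | inj₂ _ = refl
... | inj₂ _ | inj₁ _ = refl

joinAdj-irrefl : (G J : Graph) → ∀ x → joinAdj G J x x ≡ false
joinAdj-irrefl G J x with splitAt (n G) x
... | inj₁ a = irrefl G a
... | inj₂ a = irrefl J a

_∨ᴳ_ : Graph → Graph → Graph
G ∨ᴳ J = record
  { n = n G + n J
  ; adj = joinAdj G J
  ; sym = joinAdj-sym G J
  ; irrefl = joinAdj-irrefl G J
  }

-- Closed adjacency (every vertex carries a loop: a player may stay put).
CAdj : (G : Graph) → Vtx G → Vtx G → Set
CAdj G u v = (u ≡ v) ⊎ (adj G u v ≡ true)

adjToAll : (G : Graph) {k : ℕ} → Vec (Vtx G) k → Vtx G → Bool
adjToAll G []       x = true
adjToAll G (c ∷ cs) x = adj G c x ∧ adjToAll G cs x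

observe : (G : Graph) {k : ℕ} → Vec (Vtx G) k → Vtx G → Maybe (Vtx G)
observe G cs x with adjToAll G cs x
... | true  = nothing
... | false = just x

-- A (deterministic) strategy for k cops: an initial placement (multiset,
-- as a vector) and a move rule depending on the history of observations
-- (most recent first) and the current cop positions.
record CopStrategy (G : Graph) (k : ℕ) : Set where
  field
    init  : Vec (Vtx G) k
    move  : List (Maybe (Vtx G)) → Vec (Vtx G) k → Vec (Vtx G) k
    legal : ∀ h cs i → CAdj G (lookup cs i) (lookup (move h cs) i)

open CopStrategy public

-- The robber sees everything and the cops play deterministically, so a
-- robber strategy amounts to an arbitrary legal trajectory r : ℕ → V.
-- r t is the robber's position after his t-th move (r 0 = initial choice).
LegalRobber : (G : Graph) → (ℕ → Vtx G) → Set
LegalRobber G r = ∀ t → CAdj G (r t) (r (suc t))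

-- run S r t = (cop positions when robber stands at r t,
--              observations of r 0 … r (t-1), most recent first)
run : {G : Graph} {k : ℕ} → CopStrategy G k → (ℕ → Vtx G) →
      ℕ → Vec (Vtx G) k × List (Maybe (Vtx G))
run S r zero    = init S , []
run {G} S r (suc t) with run S r t
... | cs , h = move S (observe G cs (r t) ∷ h) cs , (observe G cs (r t) ∷ h)

copsAt : {G : Graph} {k : ℕ} → CopStrategy G k → (ℕ → Vtx G) → ℕ → Vec (Vtx G) k
copsAt S r t = proj₁ (run S r t)

-- Capture in round t: a cop is on the robber's vertex r t either before
-- the cops' (t+1)-th move (robber moved onto a cop / initial placement)
-- or right after it.
CapturedAt : {G : Graph} {k : ℕ} → CopStrategy G k → (ℕ → Vtx G) → ℕ → Set
CapturedAt {k = k} S r t =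
  (∃[ i ] lookup (copsAt S r t) i ≡ r t) ⊎
  (∃[ i ] lookup (copsAt S r (suc t)) i ≡ r t)

CopsWin : Graph → ℕ → Set
CopsWin G k = Σ (CopStrategy G k) λ S →
  ∀ (r : ℕ → Vtx G) → LegalRobber G r → ∃[ t ] CapturedAt S r t

HyperopicCopNumber≤ : Graph → ℕ → Set
HyperopicCopNumber≤ G m = ∃[ k ] (k ≤ m × CopsWin G k)

-- A disconnected graph has two vertices u, v with no common neighbour (vertices with a common
-- neighbour are at distance at most 2).  Put two cops on such a pair of G and two on such a
-- pair of J.  A robber choosing a vertex of G is not adjacent to both G-cops, so he is
-- visible, and each J-cop is adjacent to him in the join; one of them steps onto him in the
-- first round.  The case of a vertex of J is symmetric.
module Submission where

open import Defs
open import Data.Nat using (ℕ; z≤n; s≤s)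
open import Data.Fin using (Fin; zero; suc; splitAt; join; _↑ˡ_; _↑ʳ_)
open import Data.Fin.Properties using (any?; all?; ¬∀⟶∃¬; splitAt-↑ˡ; splitAt-↑ʳ; join-splitAt)
open import Data.Bool using (true; false)
open import Data.Bool.Properties using (_≟_; ∧-conicalˡ; ∧-conicalʳ)
open import Data.Sum using (_⊎_; inj₁; inj₂)
open import Data.Product using (∃-syntax; _×_; _,_)
open import Data.Vec using (Vec; []; _∷_; lookup; map)
open import Data.Vec.Properties using (lookup-map)
open import Data.List using (List; []; _∷_)
open import Data.Maybe using (Maybe; just; nothing)
open import Relation.Binary.PropositionalEquality using (_≡_; refl; trans; cong) renaming (sym to ≡-sym)
open import Relation.Nullary using (¬_; Dec; contradiction)
open import Relation.Nullary.Decidable using (_×-dec_)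

CommonNeighbour : (G : Graph) → Vtx G → Vtx G → Set
CommonNeighbour G u v = ∃[ x ] adj G u x ≡ true × adj G v x ≡ true

commonNeighbour? : (G : Graph) (u v : Vtx G) → Dec (CommonNeighbour G u v)
commonNeighbour? G u v = any? λ x → (adj G u x ≟ true) ×-dec (adj G v x ≟ true)

commonNeighbour⇒reachable : (G : Graph) {u v : Vtx G} → CommonNeighbour G u v → Reachable G u v
commonNeighbour⇒reachable G {v = v} (x , ux , vx) = step ux (step (trans (Graph.sym G x v) vx) here)

disconnected⇒∃¬commonNeighbour : (G : Graph) → Disconnected G →
                                  ∃[ u ] ∃[ v ] ¬ CommonNeighbour G u v
disconnected⇒∃¬commonNeighbour G disconnected
  with ¬∀⟶∃¬ (n G) _ (λ u → all? (commonNeighbour? G u))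
         (λ common → disconnected λ u v → commonNeighbour⇒reachable G (common u v))
... | u , ¬common-u with ¬∀⟶∃¬ (n G) _ (commonNeighbour? G u) ¬common-u
...   | v , ¬common-uv = u , v , ¬common-uv

module Pounce (H : Graph) where

  pounceStep : Maybe (Vtx H) → Vtx H → Vtx H
  pounceStep nothing  c = c
  pounceStep (just x) c with adj H c x
  ... | true  = x
  ... | false = c

  pounceStep-legal : ∀ o c → CAdj H c (pounceStep o c)
  pounceStep-legal nothing  c = inj₁ refl
  pounceStep-legal (just x) c with adj H c x in cx
  ... | true  = inj₂ cx
  ... | false = inj₁ refl

  pounceStep-adj : ∀ {x c} → adj H c x ≡ true → pounceStep (just x) c ≡ x
  pounceStep-adj {x} {c} cx rewrite cx = refl

  pounceMove : ∀ {k} → List (Maybe (Vtx H)) → Vec (Vtx H) k → Vec (Vtx H) k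
  pounceMove []      cs = cs
  pounceMove (o ∷ _) cs = map (pounceStep o) cs

  pounceMove-legal : ∀ {k} h (cs : Vec (Vtx H) k) i → CAdj H (lookup cs i) (lookup (pounceMove h cs) i)
  pounceMove-legal []      cs i = inj₁ refl
  pounceMove-legal (o ∷ _) cs i rewrite lookup-map i (pounceStep o) cs = pounceStep-legal o (lookup cs i)

  pounce : ∀ {k} → Vec (Vtx H) k → CopStrategy H k
  pounce cs = record { init = cs ; move = pounceMove ; legal = pounceMove-legal }

  adjToAll⇒adj : ∀ {k} (cs : Vec (Vtx H) k) {x} → adjToAll H cs x ≡ true →
                 ∀ i → adj H (lookup cs i) x ≡ true
  adjToAll⇒adj (c ∷ cs) all-x zero    = ∧-conicalˡ _ _ all-x
  adjToAll⇒adj (c ∷ cs) all-x (suc i) = adjToAll⇒adj cs (∧-conicalʳ _ _ all-x) i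

  observe-visible : ∀ {k} (cs : Vec (Vtx H) k) {x} → ¬ adjToAll H cs x ≡ true → observe H cs x ≡ just x
  observe-visible cs {x} visible with adjToAll H cs x | visible
  ... | true  | visible′ = contradiction refl visible′
  ... | false | _        = refl

  Exposed : ∀ {k} → Vec (Vtx H) k → Vtx H → Set
  Exposed cs x = ¬ adjToAll H cs x ≡ true × ∃[ i ] adj H (lookup cs i) x ≡ true

  pounce-captures : ∀ {k} (cs : Vec (Vtx H) k) (r : ℕ → Vtx H) → Exposed cs (r 0) →
                    CapturedAt (pounce cs) r 0
  pounce-captures cs r (visible , i , ci) = inj₂ (i , lands-on-robber)
    where
    lands-on-robber : lookup (map (pounceStep (observe H cs (r 0))) cs) i ≡ r 0
    lands-on-robber rewrite lookup-map i (pounceStep (observe H cs (r 0))) cs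
                          | observe-visible cs visible = pounceStep-adj ci

  exposed⇒copsWin : ∀ {k} (cs : Vec (Vtx H) k) → (∀ x → Exposed cs x) → CopsWin H k
  exposed⇒copsWin cs exposed = pounce cs , λ r _ → 0 , pounce-captures cs r (exposed (r 0))

module Join (G J : Graph) where

  inl : Vtx G → Vtx (G ∨ᴳ J)
  inl a = a ↑ˡ n J

  inr : Vtx J → Vtx (G ∨ᴳ J)
  inr c = n G ↑ʳ c

  adj-inl-inl : ∀ a b → adj (G ∨ᴳ J) (inl a) (inl b) ≡ adj G a b
  adj-inl-inl a b rewrite splitAt-↑ˡ (n G) a (n J) | splitAt-↑ˡ (n G) b (n J) = refl

  adj-inr-inr : ∀ c d → adj (G ∨ᴳ J) (inr c) (inr d) ≡ adj J c d
  adj-inr-inr c d rewrite splitAt-↑ʳ (n G) (n J) c | splitAt-↑ʳ (n G) (n J) d = refl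

  adj-inl-inr : ∀ a c → adj (G ∨ᴳ J) (inl a) (inr c) ≡ true
  adj-inl-inr a c rewrite splitAt-↑ˡ (n G) a (n J) | splitAt-↑ʳ (n G) (n J) c = refl

  adj-inr-inl : ∀ c a → adj (G ∨ᴳ J) (inr c) (inl a) ≡ true
  adj-inr-inl c a rewrite splitAt-↑ʳ (n G) (n J) c | splitAt-↑ˡ (n G) a (n J) = refl

  inl-or-inr : ∀ x → (∃[ a ] x ≡ inl a) ⊎ (∃[ c ] x ≡ inr c)
  inl-or-inr x with splitAt (n G) x in split-x
  ... | inj₁ a = inj₁ (a , trans (≡-sym (join-splitAt (n G) (n J) x)) (cong (join (n G) (n J)) split-x))
  ... | inj₂ c = inj₂ (c , trans (≡-sym (join-splitAt (n G) (n J) x)) (cong (join (n G) (n J)) split-x))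

  open Pounce (G ∨ᴳ J)

  ¬commonNeighbour⇒copsWin-join : ∀ {a b c d} → ¬ CommonNeighbour G a b → ¬ CommonNeighbour J c d →
                                  CopsWin (G ∨ᴳ J) 4
  ¬commonNeighbour⇒copsWin-join {a} {b} {c} {d} ¬common-ab ¬common-cd = exposed⇒copsWin cops exposed
    where
    cops : Vec (Vtx (G ∨ᴳ J)) 4
    cops = inl a ∷ inl b ∷ inr c ∷ inr d ∷ []

    exposed : ∀ x → Exposed cops x
    exposed x with inl-or-inr x
    ... | inj₁ (g , refl) = visible , suc (suc zero) , adj-inr-inl c g
      where
      visible : ¬ adjToAll (G ∨ᴳ J) cops (inl g) ≡ true
      visible all-g = ¬common-ab (g , trans (≡-sym (adj-inl-inl a g)) (adjToAll⇒adj cops all-g zero)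
                                    , trans (≡-sym (adj-inl-inl b g)) (adjToAll⇒adj cops all-g (suc zero)))
    ... | inj₂ (j , refl) = visible , zero , adj-inl-inr a j
      where
      visible : ¬ adjToAll (G ∨ᴳ J) cops (inr j) ≡ true
      visible all-j = ¬common-cd (j , trans (≡-sym (adj-inr-inr c j)) (adjToAll⇒adj cops all-j (suc (suc zero)))
                                    , trans (≡-sym (adj-inr-inr d j)) (adjToAll⇒adj cops all-j (suc (suc (suc zero)))))

corollary4p5 : (G J : Graph) → Disconnected G → Disconnected J →
    HyperopicCopNumber≤ (G ∨ᴳ J) 4
corollary4p5 G J disconnected-G disconnected-J
  with disconnected⇒∃¬commonNeighbour G disconnected-G | disconnected⇒∃¬commonNeighbour J disconnected-J
... | _ , _ , ¬common-G | _ , _ , ¬common-J =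
  4 , s≤s (s≤s (s≤s (s≤s z≤n))) , Join.¬commonNeighbour⇒copsWin-join G J ¬common-G ¬common-J
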